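{- Let $G$ be a finite transitive permutation group of degree $n$ and let $H_G$ be the subgroup generated by all elements of $G$ fixing at least one point. If $H_G$ is a proper subgroup of $G$ and $H_G$ contains no derangements, then $\Gamma_G$ is a complete multipartite graph with $[G:H_G]$ parts and $\rho(G)=\frac{n}{[G:H_G]}$.
   Context: A derangement is an element with no fixed point. The derangement graph $\Gamma_G$ has vertex set $G$, with $g,h$ adjacent iff $gh^{ -1}$ is a derangement. A subset $\mathcal{F}\subseteq G$ is intersecting if for all $g,h\in\mathcal{F}$ some point $\omega$ has $\omega^g=\omega^h$; with $G_\omega$ a point stabilizer of maximum size, $\rho(G)=\max\{|\mathcal{F}|/|G_\omega|:\mathcal{F}\text{ intersecting}\}$. -}

module Defs where

open import Data.Nat using (ℕ; _*_; _≤_)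
open import Data.Fin using (Fin)
open import Data.Vec using (Vec; lookup; tabulate)
open import Data.List using (List; length)
open import Data.List.Membership.Propositional using (_∈_)
open import Data.List.Relation.Unary.Unique.Propositional using (Unique)
open import Data.Product using (Σ; ∃; _×_)
open import Function.Bundles using (_⇔_)
open import Function.Definitions using (Injective)
open import Relation.Binary.PropositionalEquality using (_≡_; _≢_)

-- A permutation of {0,…,n-1} is stored as its vector of images:
-- the image ω^g of the point ω under g is  lookup g ω  (right action).
Perm : ℕ → Set
Perm n = Vec (Fin n) n

_^_ : ∀ {n} → Fin n → Perm n → Fin n
ω ^ g = lookup g ω

_·_ : ∀ {n} → Perm n → Perm n → Perm n
g · h = tabulate (λ ω → (ω ^ g) ^ h)

idP : ∀ {n} → Perm n
idP = tabulate (λ ω → ω)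

IsPerm : ∀ {n} → Perm n → Set
IsPerm g = Injective _≡_ _≡_ (lookup g)

-- A finite permutation group of degree n, given by the (duplicate-free)
-- list of its elements.  (For a finite set of permutations, closure
-- under products and containing the identity already gives closure
-- under inverses.)
record PermGroup (n : ℕ) : Set where
  field
    elems   : List (Perm n)
    unique  : Unique elems
    perms   : ∀ {g} → g ∈ elems → IsPerm g
    has-id  : idP ∈ elems
    closed  : ∀ {g h} → g ∈ elems → h ∈ elems → (g · h) ∈ elems

open PermGroup public

_∈G_ : ∀ {n} → Perm n → PermGroup n → Set
g ∈G G = g ∈ elems G

order : ∀ {n} → PermGroup n → ℕ
order G = length (elems G)

Transitive : ∀ {n} → PermGroup n → Set
Transitive {n} G = ∀ (α β : Fin n) → Σ (Perm n) λ g → g ∈G G × (α ^ g ≡ β)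

Derangement : ∀ {n} → Perm n → Set
Derangement g = ∀ ω → ω ^ g ≢ ω

FixesAPoint : ∀ {n} → Perm n → Set
FixesAPoint {n} g = Σ (Fin n) λ ω → ω ^ g ≡ ω

-- H_G: the subgroup generated by the elements of G fixing at least one
-- point (the closure under identity and products; since the generating
-- set is closed under inverses and G is finite this is the generated
-- subgroup).
data H_ {n : ℕ} (G : PermGroup n) : Perm n → Set where
  gen : ∀ {g} → g ∈G G → FixesAPoint g → H_ G g
  one : H_ G idP
  mul : ∀ {g h} → H_ G g → H_ G h → H_ G (g · h)

HasSize : ∀ {n} → (Perm n → Set) → ℕ → Set
HasSize {n} P m =
  Σ (List (Perm n)) λ L → Unique L × (∀ x → (x ∈ L) ⇔ P x) × (length L ≡ m)

HasIndex : ∀ {n} → (G : PermGroup n) → (Perm n → Set) → ℕ → Set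
HasIndex G H k = Σ ℕ λ m → HasSize H m × (k * m ≡ order G)

-- Derangement graph: g ~ h iff g h⁻¹ is a derangement, where g h⁻¹ is
-- the (unique) element k of G with k · h = g.
Adj : ∀ {n} → PermGroup n → Perm n → Perm n → Set
Adj {n} G g h = Σ (Perm n) λ k → k ∈G G × (k · h ≡ g) × Derangement k

CompleteMultipartite : ∀ {n} → PermGroup n → ℕ → Set
CompleteMultipartite {n} G k =
  Σ (Perm n → Fin k) λ part →
    (∀ i → Σ (Perm n) λ g → g ∈G G × part g ≡ i) ×
    (∀ {g h} → g ∈G G → h ∈G G → Adj G g h ⇔ (part g ≢ part h))

Stab : ∀ {n} → PermGroup n → Fin n → Perm n → Set
Stab G ω g = g ∈G G × (ω ^ g ≡ ω)

MaxStabSize : ∀ {n} → PermGroup n → ℕ → Set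
MaxStabSize {n} G s =
  (Σ (Fin n) λ ω → HasSize (Stab G ω) s) ×
  (∀ ω s' → HasSize (Stab G ω) s' → s' ≤ s)

Intersecting : ∀ {n} → PermGroup n → List (Perm n) → Set
Intersecting {n} G F =
  Unique F × (∀ {g} → g ∈ F → g ∈G G) ×
  (∀ {g h} → g ∈ F → h ∈ F → Σ (Fin n) λ ω → ω ^ g ≡ ω ^ h)

-- ρ(G) = p / q  (q > 0), i.e. max { |F| / |G_ω| : F intersecting } = p/q,
-- written with cross-multiplication in ℕ.
RhoEq : ∀ {n} → PermGroup n → ℕ → ℕ → Set
RhoEq {n} G p q =
  Σ ℕ λ s → MaxStabSize G s ×
    (∀ F → Intersecting G F → length F * q ≤ p * s) ×
    (Σ (List (Perm n)) λ F → Intersecting G F × (length F * q ≡ p * s))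

-- Call g, h agreeing when ω^g = ω^h for some ω, i.e. when g h⁻¹ fixes a point. As H_G has no
-- derangements, the elements of G fixing a point are exactly H_G, a subgroup, so agreement is the
-- relation of lying in a common right coset of H_G: Γ_G joins exactly the elements of different
-- cosets, and is complete multipartite with [G : H_G] parts. Translating an intersecting family F
-- by f⁻¹ (f ∈ F) lands it in H_G, so |F| ≤ |H_G|, with equality for F = H_G. By orbit-stabiliser
-- |G_ω| = |G|/n, hence ρ(G) = |H_G| n / |G| = n / [G : H_G].
module Submission where

open import Defs
open import Data.Nat using (ℕ; zero; suc; _+_; _*_; _≤_; z≤n)
open import Data.Nat.Properties
  using (+-0-commutativeMonoid; ≤-antisym; ≤-reflexive; ≤-trans; <⇒≱; *-cancelˡ-≡; *-comm; *-monoˡ-≤)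
open import Algebra.Properties.CommutativeMonoid.Sum +-0-commutativeMonoid
  using (sum; sum-syntax; sum-remove; sum-cong-≗; sum-replicate-zero)
open import Data.Fin using (Fin; zero; suc; punchIn; _≟_)
open import Data.Fin.Properties using (punchInᵢ≢i; injective⇒≤; ¬∀⟶∃¬)
import Data.Fin.Properties as Fin
import Data.Vec as Vec
open import Data.Vec.Properties using (lookup∘tabulate; tabulate∘lookup; tabulate-cong; ≡-dec)
open import Data.Vec.Functional using (removeAt)
open import Data.List using (List; []; _∷_; length; lookup; filter; deduplicate)
open import Data.List.Properties using (filter-accept; filter-reject; filter-notAll)
open import Data.List.Membership.Propositional using (_∈_; find; lose)
open import Data.List.Membership.Propositional.Properties
  using (∈-lookup; ∈-filter⁺; ∈-filter⁻; ∈-deduplicate⁻)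
open import Data.List.Relation.Unary.Any using (Any; here; there; index; any?)
import Data.List.Relation.Unary.Any as Any
open import Data.List.Relation.Unary.Any.Properties using (lookup-result; lookup-index)
import Data.List.Relation.Unary.Any.Properties as AnyP
import Data.List.Relation.Unary.All as All
open import Data.List.Relation.Unary.All.Properties using (all-filter)
open import Data.List.Relation.Unary.AllPairs using (AllPairs; []; _∷_)
import Data.List.Relation.Unary.AllPairs.Properties as AllPairs
open import Data.List.Relation.Unary.Unique.Propositional using (Unique)
import Data.List.Relation.Unary.Unique.Propositional.Properties as Unique
open import Data.Product using (Σ; ∃; _×_; _,_; proj₁)
open import Data.Sum using (inj₁; inj₂)
open import Data.Empty using (⊥-elim)
open import Function using (_∘_; id)
open import Function.Bundles using (_⇔_; mk⇔; Equivalence)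
open import Function.Definitions using (Injective)
open import Relation.Nullary using (¬_; yes; no; ¬?; contradiction)
import Relation.Nullary.Decidable as Dec
open import Relation.Nullary.Decidable using (decidable-stable)
open import Relation.Unary using (Decidable)
open import Relation.Binary using (Symmetric; DecidableEquality)
import Relation.Binary as B
open import Relation.Binary.PropositionalEquality

module _ {X : Set} where

  pairwise-lookup-injective : ∀ {R : X → X → Set} {xs} → Symmetric R →
    AllPairs (λ x y → ¬ R x y) xs → ∀ {i j} → R (lookup xs i) (lookup xs j) → i ≡ j
  pairwise-lookup-injective _   (_ ∷ _)     {zero}  {zero}  _   = refl
  pairwise-lookup-injective _   (x≁ ∷ _)    {zero}  {suc j} xRy =
    contradiction xRy (All.lookup x≁ (∈-lookup j))
  pairwise-lookup-injective sym (x≁ ∷ _)    {suc i} {zero}  yRx =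
    contradiction (sym yRx) (All.lookup x≁ (∈-lookup i))
  pairwise-lookup-injective sym (_ ∷ apart) {suc i} {suc j} xRy =
    cong suc (pairwise-lookup-injective sym apart xRy)

  length-≤-injective-image : ∀ {Y : Set} {f : X → Y} {xs ys} → Injective _≡_ _≡_ f → Unique xs →
    (∀ {x} → x ∈ xs → f x ∈ ys) → length xs ≤ length ys
  length-≤-injective-image {f = f} {xs} {ys} f-injective xs! f-into = injective⇒≤ position-injective
    where
    position : Fin (length xs) → Fin (length ys)
    position i = index (f-into (∈-lookup i))

    position-injective : Injective _≡_ _≡_ position
    position-injective {i} {j} eq = pairwise-lookup-injective sym xs! (f-injective (begin
      f (lookup xs i)        ≡⟨ lookup-index (f-into (∈-lookup i)) ⟩
      lookup ys (position i) ≡⟨ cong (lookup ys) eq ⟩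
      lookup ys (position j) ≡⟨ lookup-index (f-into (∈-lookup j)) ⟨
      f (lookup xs j)        ∎))
      where open ≡-Reasoning

  module _ (_≟X_ : DecidableEquality X) where

    injective-endo-onto : ∀ {f : X → X} {xs} → Injective _≡_ _≡_ f → Unique xs →
      (∀ {x} → x ∈ xs → f x ∈ xs) → ∀ {y} → y ∈ xs → ∃ λ x → x ∈ xs × f x ≡ y
    injective-endo-onto {f} {xs} f-injective xs! f-into {y} y∈ with any? (λ x → f x ≟X y) xs
    ... | yes hit = find hit
    ... | no miss = contradiction (length-≤-injective-image f-injective xs! f-into-others)
                                  (<⇒≱ (filter-notAll others? xs y-not-other))
      where
      others? : Decidable (λ x → ¬ x ≡ y)
      others? x = ¬? (x ≟X y)

      f-into-others : ∀ {x} → x ∈ xs → f x ∈ filter others? xs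
      f-into-others x∈ = ∈-filter⁺ others? (f-into x∈) (λ fx≡y → miss (lose x∈ fx≡y))

      y-not-other : Any (λ x → ¬ ¬ x ≡ y) xs
      y-not-other = Any.map (λ y≡x x≢y → x≢y (sym y≡x)) y∈

  module _ {R : X → X → Set} (R? : B.Decidable R) where

    deduplicate-pairwise : ∀ xs → AllPairs (λ x y → ¬ R x y) (deduplicate R? xs)
    deduplicate-pairwise []       = []
    deduplicate-pairwise (x ∷ xs) =
      all-filter (¬? ∘ R? x) (deduplicate R? xs) ∷ AllPairs.filter⁺ (¬? ∘ R? x) (deduplicate-pairwise xs)

    -- Any.deduplicate⁺ asks P to respect R on all of X; here only on the members of xs.
    deduplicate-covers : ∀ {P : X → Set} {xs} →
      (∀ {x y} → x ∈ xs → y ∈ xs → R y x → P x → P y) → Any P xs → Any P (deduplicate R? xs)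
    deduplicate-covers resp (here px) = here px
    deduplicate-covers {xs = x ∷ xs} resp (there pxs)
      with covered ← deduplicate-covers (λ x∈ y∈ → resp (there x∈) (there y∈)) pxs
      with AnyP.filter⁺ (¬? ∘ R? x) covered
    ... | inj₁ kept    = there kept
    ... | inj₂ removed =
      here (resp (there (∈-deduplicate⁻ R? xs (∈-lookup (index covered)))) (here refl)
                 (decidable-stable (R? x _) removed) (lookup-result covered))

fibre : ∀ {X : Set} {k} → (X → Fin k) → List X → Fin k → List X
fibre p xs i = filter (λ x → p x ≟ i) xs

length-≡-∑-fibres : ∀ {X : Set} {k} (p : X → Fin k) xs → length xs ≡ ∑[ i < k ] length (fibre p xs i)
length-≡-∑-fibres {k = k}     p []       = sym (sum-replicate-zero k)
length-≡-∑-fibres {k = zero}  p (x ∷ _)  with () ← p x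
length-≡-∑-fibres {X} {suc k} p (x ∷ xs) = begin
  suc (length xs)                                                ≡⟨ cong suc (length-≡-∑-fibres p xs) ⟩
  suc (sum (sizes xs))                                           ≡⟨ cong suc (sum-remove {i = p x} (sizes xs)) ⟩
  suc (sizes xs (p x) + sum (removeAt (sizes xs) (p x)))         ≡⟨ cong₂ _+_ hit (sum-cong-≗ miss) ⟩
  sizes (x ∷ xs) (p x) + sum (removeAt (sizes (x ∷ xs)) (p x))   ≡⟨ sum-remove {i = p x} (sizes (x ∷ xs)) ⟨
  sum (sizes (x ∷ xs))                                           ∎
  where
  open ≡-Reasoning

  sizes : List X → Fin (suc k) → ℕ
  sizes ys i = length (fibre p ys i)

  hit : suc (sizes xs (p x)) ≡ sizes (x ∷ xs) (p x)
  hit = cong length (sym (filter-accept (λ y → p y ≟ p x) refl))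

  miss : ∀ j → sizes xs (punchIn (p x) j) ≡ sizes (x ∷ xs) (punchIn (p x) j)
  miss j = cong length (sym (filter-reject (λ y → p y ≟ punchIn (p x) j) (punchInᵢ≢i (p x) j ∘ sym)))

∑-const : ∀ k m → ∑[ i < k ] m ≡ k * m
∑-const zero    m = refl
∑-const (suc k) m = cong (m +_) (∑-const k m)

length-uniform-fibres : ∀ {X : Set} {k m} (p : X → Fin k) xs →
  (∀ i → length (fibre p xs i) ≡ m) → length xs ≡ k * m
length-uniform-fibres {k = k} {m} p xs uniform =
  trans (length-≡-∑-fibres p xs) (trans (sum-cong-≗ uniform) (∑-const k m))

module _ {n : ℕ} where

  HasSize-unique : ∀ {P : Perm n → Set} {a b} → HasSize P a → HasSize P b → a ≡ b
  HasSize-unique (xs , xs! , xs⇔P , refl) (ys , ys! , ys⇔P , refl) = ≤-antisym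
    (length-≤-injective-image id xs! (λ {x} → Equivalence.from (ys⇔P x) ∘ Equivalence.to (xs⇔P x)))
    (length-≤-injective-image id ys! (λ {x} → Equivalence.from (xs⇔P x) ∘ Equivalence.to (ys⇔P x)))

  HasSize-cong : ∀ {P Q : Perm n → Set} {m} → (∀ x → P x ⇔ Q x) → HasSize P m → HasSize Q m
  HasSize-cong P⇔Q (xs , xs! , xs⇔P , len) =
    xs , xs! , (λ x → mk⇔ (Equivalence.to (P⇔Q x) ∘ Equivalence.to (xs⇔P x))
                          (Equivalence.from (xs⇔P x) ∘ Equivalence.from (P⇔Q x))) , len

  HasSize-filter : ∀ {P : Perm n → Set} (P? : Decidable P) {xs} → Unique xs →
    HasSize (λ x → x ∈ xs × P x) (length (filter P? xs))
  HasSize-filter P? {xs} xs! =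
    filter P? xs , Unique.filter⁺ P? xs! ,
    (λ x → mk⇔ (∈-filter⁻ P?) λ (x∈ , Px) → ∈-filter⁺ P? x∈ Px) , refl

  _≟P_ : DecidableEquality (Perm n)
  _≟P_ = ≡-dec _≟_

  ^-· : ∀ (g h : Perm n) ω → ω ^ (g · h) ≡ (ω ^ g) ^ h
  ^-· g h = lookup∘tabulate (λ ω → (ω ^ g) ^ h)

  ^-idP : ∀ (ω : Fin n) → ω ^ idP ≡ ω
  ^-idP = lookup∘tabulate id

  Perm-ext : ∀ {g h : Perm n} → (∀ ω → ω ^ g ≡ ω ^ h) → g ≡ h
  Perm-ext {g} {h} eq = trans (sym (tabulate∘lookup g)) (trans (tabulate-cong eq) (tabulate∘lookup h))

  ·-assoc : ∀ (g h l : Perm n) → (g · h) · l ≡ g · (h · l)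
  ·-assoc g h l = Perm-ext λ ω → begin
    ω ^ ((g · h) · l)  ≡⟨ ^-· (g · h) l ω ⟩
    (ω ^ (g · h)) ^ l  ≡⟨ cong (_^ l) (^-· g h ω) ⟩
    ((ω ^ g) ^ h) ^ l  ≡⟨ ^-· h l (ω ^ g) ⟨
    (ω ^ g) ^ (h · l)  ≡⟨ ^-· g (h · l) ω ⟨
    ω ^ (g · (h · l))  ∎
    where open ≡-Reasoning

  ·-cancelʳ : ∀ a → IsPerm a → Injective _≡_ _≡_ (_· a)
  ·-cancelʳ a a-perm {g} {h} ga≡ha = Perm-ext λ ω →
    a-perm (trans (sym (^-· g a ω)) (trans (cong (ω ^_) ga≡ha) (^-· h a ω)))

  fixesAPoint? : Decidable (FixesAPoint {n})
  fixesAPoint? g = Fin.any? (λ ω → ω ^ g ≟ ω)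

  ¬derangement⇒fixesAPoint : ∀ g → ¬ Derangement g → FixesAPoint g
  ¬derangement⇒fixesAPoint g ¬deranged
    with ω , ¬moved ← ¬∀⟶∃¬ n _ (λ ω → ¬? (ω ^ g ≟ ω)) ¬deranged =
    ω , decidable-stable (ω ^ g ≟ ω) ¬moved

  record Agree (g h : Perm n) : Set where
    constructor agree-at
    field
      point  : Fin n
      agrees : point ^ g ≡ point ^ h

  agree? : B.Decidable Agree
  agree? g h = Dec.map′ (λ (ω , eq) → agree-at ω eq) (λ (agree-at ω eq) → ω , eq)
                        (Fin.any? (λ ω → ω ^ g ≟ ω ^ h))

  agree-sym : Symmetric Agree
  agree-sym (agree-at ω eq) = agree-at ω (sym eq)

  agree-·⇔fixesAPoint : ∀ k h → IsPerm h → Agree (k · h) h ⇔ FixesAPoint k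
  agree-·⇔fixesAPoint k h h-perm =
    mk⇔ (λ (agree-at ω eq) → ω , h-perm (trans (sym (^-· k h ω)) eq))
        (λ (ω , fix) → agree-at ω (trans (^-· k h ω) (cong (_^ h) fix)))

  agree⇒fixesAPoint-·-inverse : ∀ {g r} u → (∀ ω → (ω ^ r) ^ u ≡ ω) →
    Agree g r → FixesAPoint (g · u)
  agree⇒fixesAPoint-·-inverse {g} u u-inverse (agree-at ω eq) =
    ω , trans (^-· g u ω) (trans (cong (_^ u) eq) (u-inverse ω))

  agree-idP : ∀ {g} → FixesAPoint g → Agree g idP
  agree-idP (ω , fix) = agree-at ω (trans fix (sym (^-idP ω)))

agree-refl : ∀ {m} {g : Perm (suc m)} → Agree g g
agree-refl = agree-at zero refl

module _ {n : ℕ} (G : PermGroup n) where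

  ·-cancelʳ-∈G : ∀ {a} → a ∈G G → Injective _≡_ _≡_ (_· a)
  ·-cancelʳ-∈G {a} a∈ = ·-cancelʳ a (perms G a∈)

  divideʳ : ∀ {g h} → g ∈G G → h ∈G G → ∃ λ k → k ∈G G × k · h ≡ g
  divideʳ g∈ h∈ =
    injective-endo-onto _≟P_ (·-cancelʳ-∈G h∈) (unique G) (λ k∈ → closed G k∈ h∈) g∈

  inverseʳ : ∀ {h} → h ∈G G → ∃ λ u → u ∈G G × ∀ ω → (ω ^ h) ^ u ≡ ω
  inverseʳ {h} h∈ with u , u∈ , uh≡id ← divideʳ (has-id G) h∈ =
    u , u∈ , λ ω → perms G h∈ (begin
      ((ω ^ h) ^ u) ^ h  ≡⟨ ^-· u h (ω ^ h) ⟨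
      (ω ^ h) ^ (u · h)  ≡⟨ cong ((ω ^ h) ^_) uh≡id ⟩
      (ω ^ h) ^ idP      ≡⟨ ^-idP (ω ^ h) ⟩
      ω ^ h              ∎)
    where open ≡-Reasoning

  agree⇔quotient-fixesAPoint : ∀ k {h g} → h ∈G G → k · h ≡ g → Agree g h ⇔ FixesAPoint k
  agree⇔quotient-fixesAPoint k {h} h∈ refl = agree-·⇔fixesAPoint k h (perms G h∈)

  H-⊆-G : ∀ {g} → H_ G g → g ∈G G
  H-⊆-G (gen g∈ _) = g∈
  H-⊆-G one        = has-id G
  H-⊆-G (mul g h)  = closed G (H-⊆-G g) (H-⊆-G h)

  filter-translate-≤ : ∀ {P Q : Perm n → Set} (P? : Decidable P) (Q? : Decidable Q) {a} → a ∈G G →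
    (∀ {g} → g ∈G G → P g → Q (g · a)) → length (filter P? (elems G)) ≤ length (filter Q? (elems G))
  filter-translate-≤ P? Q? a∈ P⇒Q =
    length-≤-injective-image (·-cancelʳ-∈G a∈) (Unique.filter⁺ P? (unique G)) λ g∈ →
      let g∈G , Pg = ∈-filter⁻ P? g∈ in ∈-filter⁺ Q? (closed G g∈G a∈) (P⇒Q g∈G Pg)

  stabiliser : Fin n → List (Perm n)
  stabiliser ω = fibre (ω ^_) (elems G) ω

  stabiliser-size : ∀ ω → HasSize (Stab G ω) (length (stabiliser ω))
  stabiliser-size ω = HasSize-filter (λ g → ω ^ g ≟ ω) (unique G)

  orbit-fibre-translate-≤ : ∀ {ω α β t} → t ∈G G → α ^ t ≡ β →
    length (fibre (ω ^_) (elems G) α) ≤ length (fibre (ω ^_) (elems G) β)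
  orbit-fibre-translate-≤ {ω} {t = t} t∈ α^t≡β =
    filter-translate-≤ _ _ t∈ λ {g} _ ω^g≡α → trans (^-· g t ω) (trans (cong (_^ t) ω^g≡α) α^t≡β)

  orbit-stabiliser : Transitive G → ∀ ω → order G ≡ n * length (stabiliser ω)
  orbit-stabiliser transitive ω = length-uniform-fibres (ω ^_) (elems G) λ β →
    let t , t∈ , ω^t≡β = transitive ω β
        t′ , t′∈ , β^t′≡ω = transitive β ω
    in ≤-antisym (orbit-fibre-translate-≤ t′∈ β^t′≡ω) (orbit-fibre-translate-≤ t∈ ω^t≡β)

module _ {m : ℕ} (G : PermGroup (suc m)) where

  stabiliser-size-max : Transitive G → MaxStabSize G (length (stabiliser G zero))
  stabiliser-size-max transitive = (zero , stabiliser-size G zero) , λ ω s size →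
    ≤-reflexive (trans (HasSize-unique size (stabiliser-size G ω))
      (*-cancelˡ-≡ _ _ (suc m)
        (trans (sym (orbit-stabiliser G transitive ω)) (orbit-stabiliser G transitive zero))))

  module _ (H-derangement-free : ∀ g → H_ G g → ¬ Derangement g) where

    H-fixesAPoint : ∀ {g} → H_ G g → FixesAPoint g
    H-fixesAPoint {g} g∈H = ¬derangement⇒fixesAPoint g (H-derangement-free g g∈H)

    fixesAPoint⇔H : ∀ g → (g ∈G G × FixesAPoint g) ⇔ H_ G g
    fixesAPoint⇔H g = mk⇔ (λ (g∈ , fix) → gen g∈ fix) (λ g∈H → H-⊆-G G g∈H , H-fixesAPoint g∈H)

    -- The elements fixing a point are closed under products, so agreement is transitive.
    agree-trans : ∀ {g h l} → g ∈G G → h ∈G G → l ∈G G → Agree g h → Agree h l → Agree g l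
    agree-trans {g} {h} {l} g∈ h∈ l∈ g~h h~l
      with k₁ , k₁∈ , k₁h≡g ← divideʳ G g∈ h∈ | k₂ , k₂∈ , k₂l≡h ← divideʳ G h∈ l∈ =
      Equivalence.from (agree⇔quotient-fixesAPoint G (k₁ · k₂) l∈ k₁k₂l≡g)
        (H-fixesAPoint (mul (gen k₁∈ k₁-fixes) (gen k₂∈ k₂-fixes)))
      where
      k₁-fixes : FixesAPoint k₁
      k₁-fixes = Equivalence.to (agree⇔quotient-fixesAPoint G k₁ h∈ k₁h≡g) g~h
      k₂-fixes : FixesAPoint k₂
      k₂-fixes = Equivalence.to (agree⇔quotient-fixesAPoint G k₂ l∈ k₂l≡h) h~l
      k₁k₂l≡g : (k₁ · k₂) · l ≡ g
      k₁k₂l≡g = trans (·-assoc k₁ k₂ l) (trans (cong (k₁ ·_) k₂l≡h) k₁h≡g)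

    representatives : List (Perm (suc m))
    representatives = deduplicate agree? (elems G)

    parts : ℕ
    parts = length representatives

    representative-∈G : ∀ i → lookup representatives i ∈G G
    representative-∈G i = ∈-deduplicate⁻ agree? (elems G) (∈-lookup i)

    represented : ∀ {g} → g ∈G G → Any (Agree g) representatives
    represented g∈ = deduplicate-covers agree?
      (λ x∈ y∈ y~x g~x → agree-trans g∈ x∈ y∈ g~x (agree-sym y~x)) (lose g∈ agree-refl)

    -- Outside G the part is a junk value.
    part : Perm (suc m) → Fin parts
    part g with any? (agree? g) representatives
    ... | yes found = index found
    ... | no _      = index (represented (has-id G))

    agree-part : ∀ {g} → g ∈G G → Agree g (lookup representatives (part g))
    agree-part {g} g∈ with any? (agree? g) representatives
    ... | yes found = lookup-result found
    ... | no none   = contradiction (represented g∈) none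

    part-unique : ∀ {g} i → g ∈G G → Agree g (lookup representatives i) → part g ≡ i
    part-unique i g∈ g~r = pairwise-lookup-injective agree-sym (deduplicate-pairwise agree? (elems G))
      (agree-trans (representative-∈G _) g∈ (representative-∈G i) (agree-sym (agree-part g∈)) g~r)

    same-part⇔agree : ∀ {g h} → g ∈G G → h ∈G G → part g ≡ part h ⇔ Agree g h
    same-part⇔agree {g} g∈ h∈ = mk⇔
      (λ same → agree-trans g∈ (representative-∈G _) h∈
                  (subst (λ i → Agree g (lookup representatives i)) same (agree-part g∈))
                  (agree-sym (agree-part h∈)))
      (λ g~h → part-unique _ g∈ (agree-trans g∈ h∈ (representative-∈G _) g~h (agree-part h∈)))

    complete-multipartite : CompleteMultipartite G parts
    complete-multipartite = part , inhabited , adjacent⇔different-parts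
      where
      inhabited : ∀ i → Σ (Perm (suc m)) λ g → g ∈G G × part g ≡ i
      inhabited i = lookup representatives i , representative-∈G i , part-unique i (representative-∈G i) agree-refl

      adjacent⇔different-parts : ∀ {g h} → g ∈G G → h ∈G G → Adj G g h ⇔ (part g ≢ part h)
      adjacent⇔different-parts g∈ h∈ = mk⇔
        (λ (k , _ , kh≡g , deranged) same →
          let ω , fix = Equivalence.to (agree⇔quotient-fixesAPoint G k h∈ kh≡g)
                          (Equivalence.to (same-part⇔agree g∈ h∈) same)
          in deranged ω fix)
        (λ different → let k , k∈ , kh≡g = divideʳ G g∈ h∈ in
          k , k∈ , kh≡g , λ ω fix → different (Equivalence.from (same-part⇔agree g∈ h∈)
                            (Equivalence.from (agree⇔quotient-fixesAPoint G k h∈ kh≡g) (ω , fix))))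

    fixers : List (Perm (suc m))
    fixers = filter fixesAPoint? (elems G)

    H-size : HasSize (H_ G) (length fixers)
    H-size = HasSize-cong fixesAPoint⇔H (HasSize-filter fixesAPoint? (unique G))

    -- Right multiplication by the representative r of part i maps H into part i, and by r⁻¹ back.
    part-size : ∀ i → length (fibre part (elems G) i) ≡ length fixers
    part-size i with u , u∈ , u-inverse ← inverseʳ G (representative-∈G i) = ≤-antisym
      (filter-translate-≤ G _ _ u∈ λ {g} g∈ part≡i → agree⇒fixesAPoint-·-inverse u u-inverse
        (subst (λ j → Agree g (lookup representatives j)) part≡i (agree-part g∈)))
      (filter-translate-≤ G _ _ r∈ λ {g} g∈ fix →
        part-unique i (closed G g∈ r∈) (Equivalence.from (agree⇔quotient-fixesAPoint G g r∈ refl) fix))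
      where
      r∈ : lookup representatives i ∈G G
      r∈ = representative-∈G i

    lagrange : order G ≡ parts * length fixers
    lagrange = length-uniform-fibres part (elems G) part-size

    intersecting-≤-fixers : ∀ {F} → Intersecting G F → length F ≤ length fixers
    intersecting-≤-fixers {[]}    _ = z≤n
    intersecting-≤-fixers {f ∷ F} (F! , F⊆G , intersecting)
      with u , u∈ , u-inverse ← inverseʳ G (F⊆G (here refl)) =
      length-≤-injective-image (·-cancelʳ-∈G G u∈) F! λ {x} x∈ →
        let ω , eq = intersecting x∈ (here refl) in
        ∈-filter⁺ fixesAPoint? (closed G (F⊆G x∈) u∈)
          (agree⇒fixesAPoint-·-inverse u u-inverse (agree-at {g = x} {h = f} ω eq))

    fixers-intersecting : Intersecting G fixers
    fixers-intersecting = Unique.filter⁺ fixesAPoint? (unique G) , proj₁ ∘ ∈-filter⁻ fixesAPoint? ,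
      λ g∈ h∈ → let g∈G , g-fixes = ∈-filter⁻ fixesAPoint? g∈
                    h∈G , h-fixes = ∈-filter⁻ fixesAPoint? h∈
                    agree-at ω eq = agree-trans g∈G (has-id G) h∈G
                                      (agree-idP g-fixes) (agree-sym (agree-idP h-fixes))
                in ω , eq

    H-index : HasIndex G (H_ G) parts
    H-index = length fixers , H-size , sym lagrange

    ρ≡degree/index : Transitive G → RhoEq G (suc m) parts
    ρ≡degree/index transitive =
      length (stabiliser G zero) , stabiliser-size-max transitive ,
      (λ F F-intersecting →
        ≤-trans (*-monoˡ-≤ parts (intersecting-≤-fixers F-intersecting)) (≤-reflexive |H|k≡ns)) ,
      fixers , fixers-intersecting , |H|k≡ns
      where
      |H|k≡ns : length fixers * parts ≡ suc m * length (stabiliser G zero)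
      |H|k≡ns = trans (*-comm (length fixers) parts) (trans (sym lagrange) (orbit-stabiliser G transitive zero))

-- Properness of H_G is needed only to rule out degree 0, where idP is the one permutation.
corollary2p12 : (n : ℕ) (G : PermGroup n) → Transitive G →
    (Σ (Perm n) λ g → g ∈G G × ¬ H_ G g) →
    (∀ g → H_ G g → ¬ Derangement g) →
    Σ ℕ λ k → HasIndex G (H_ G) k × CompleteMultipartite G k × RhoEq G n k
corollary2p12 zero    G _          (Vec.[] , _ , ∉H) _              = ⊥-elim (∉H one)
corollary2p12 (suc m) G transitive _              H-derangement-free =
  parts G H-derangement-free ,
  H-index G H-derangement-free ,
  complete-multipartite G H-derangement-free ,
  ρ≡degree/index G H-derangement-free transitive
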